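{- Let $G$ be a graph, let $S_1,\ldots,S_s$ be pairwise disjoint vertex sets of $G$, and let $P_1,\ldots,P_s$ be paths in $G$, each of length at most $t$. Then there is a subset $I\subset\{1,\ldots,s\}$ with $|I|\geq s/(2t+3)$ such that $S_i\cap P_j=\emptyset$ for all distinct $i,j\in I$.
   Context: The length of a path is its number of edges; $S_i\cap P_j$ denotes the intersection of $S_i$ with the vertex set of $P_j$. -}

module Defs where

open import Data.Nat using (ℕ; _≤_)
open import Data.Fin using (Fin)
open import Data.List using (List; length; _∷_)
open import Data.List.Relation.Unary.Unique.Propositional using (Unique)
open import Data.List.Relation.Unary.Linked using (Linked)
open import Relation.Binary.PropositionalEquality using (_≡_)
open import Relation.Nullary using (¬_)
open import Level using (0ℓ; suc)

record Graph (n : ℕ) : Set₁ where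
  field
    Adj   : Fin n → Fin n → Set
    sym   : ∀ {u v} → Adj u v → Adj v u
    irrefl : ∀ {v} → ¬ Adj v v

open Graph public

record Path {n : ℕ} (G : Graph n) : Set where
  constructor mkPath
  field
    start    : Fin n
    rest     : List (Fin n)
    distinct : Unique (start ∷ rest)
    adjacent : Linked (Adj G) (start ∷ rest)

  vertices : List (Fin n)
  vertices = start ∷ rest

  -- length = number of edges
  len : ℕ
  len = length rest

open Path public

module Submission where

-- Say i conflicts with j when S i meets P j.  As the S i are disjoint and P j has at
-- most t + 1 vertices, every j is hit by at most d = t + 1 conflicts.  Double counting
-- then bounds the average number of indices in conflict with an index (either way, or
-- equal to it) by 2d + 1 = 2t + 3.  Greedily keep an index of least such degree, discard
-- everything in conflict with it and recurse: each kept index discards at most 2t + 3.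

open import Defs hiding (sym)
open import Data.Nat using (ℕ; suc; _≤_; _<_; _+_; _*_; z≤n; s≤s)
open import Data.Nat.Properties
open import Data.Nat.ListAction using (sum)
open import Algebra.Properties.CommutativeSemigroup +-commutativeSemigroup using (interchange)
open import Data.Nat.Tactic.RingSolver using (solve-∀)
open import Data.Fin using (Fin; zero; suc)
import Data.Fin as Fin
open import Data.Fin.Subset using (Subset; _∈_; _∉_; ∣_∣; ⊥; ⁅_⁆; _∪_; inside; outside)
open import Data.Fin.Subset.Properties using (_∈?_; ∉⊥; ∣⊥∣≡0; x∈p∪q⁻; x∈⁅y⁆⇒x≡y; ∪-identityˡ)
open import Data.List using (List; []; _∷_; length; map; filter; allFin)
open import Data.List.Properties using (length-tabulate)
open import Data.List.Membership.Propositional using (lose) renaming (_∈_ to _∈ₗ_)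
open import Data.List.Membership.Propositional.Properties using (∈-filter⁻)
open import Data.List.Relation.Binary.Subset.Propositional using (_⊆_)
open import Data.List.Relation.Unary.All as All using (All; []; _∷_)
open import Data.List.Relation.Unary.AllPairs using ([]; _∷_)
open import Data.List.Relation.Unary.Any using (Any; here; there; any?)
open import Data.List.Relation.Unary.Unique.Propositional using (Unique)
open import Data.List.Relation.Unary.Unique.Propositional.Properties using (allFin⁺; filter⁺)
open import Data.Bool using (if_then_else_)
open import Data.Vec using (here; there) renaming (_∷_ to _∷ᵥ_)
open import Data.Product using (Σ; _×_; _,_; ∃-syntax; proj₁; proj₂)
open import Data.Sum using (_⊎_; inj₁; inj₂)
open import Function using (_∘_; id)
open import Level using (Level; _⊔_)
open import Relation.Binary.Definitions using (DecidableEquality)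
open import Relation.Binary.PropositionalEquality using (_≡_; _≢_; refl; sym; trans; cong; cong₂; subst₂; module ≡-Reasoning)
open import Relation.Nullary using (¬_; Dec; does; yes; no; contradiction; _⊎-dec_)
open import Relation.Unary using (Pred; Decidable; ∁)
open import Relation.Unary.Properties using (∁?)

private
  variable
    a b ℓ : Level
    A B : Set a

∑ : List A → (A → ℕ) → ℕ
∑ xs f = sum (map f xs)

∑-mono-≤ : ∀ xs {f g : A → ℕ} → (∀ x → f x ≤ g x) → ∑ xs f ≤ ∑ xs g
∑-mono-≤ []       f≤g = z≤n
∑-mono-≤ (x ∷ xs) f≤g = +-mono-≤ (f≤g x) (∑-mono-≤ xs f≤g)

∑-const : ∀ xs (c : ℕ) → ∑ xs (λ (_ : A) → c) ≡ length xs * c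
∑-const []       c = refl
∑-const (x ∷ xs) c = cong (c +_) (∑-const xs c)

∑-+ : ∀ xs (f g : A → ℕ) → ∑ xs (λ x → f x + g x) ≡ ∑ xs f + ∑ xs g
∑-+ []       f g = refl
∑-+ (x ∷ xs) f g = begin
  f x + g x + ∑ xs (λ x → f x + g x) ≡⟨ cong (f x + g x +_) (∑-+ xs f g) ⟩
  f x + g x + (∑ xs f + ∑ xs g)      ≡⟨ interchange (f x) (g x) _ _ ⟩
  f x + ∑ xs f + (g x + ∑ xs g)      ∎
  where open ≡-Reasoning

∑-comm : ∀ xs ys (f : A → B → ℕ) →
         ∑ xs (λ x → ∑ ys (f x)) ≡ ∑ ys (λ y → ∑ xs (λ x → f x y))
∑-comm []       ys f = sym (trans (∑-const ys 0) (*-zeroʳ (length ys)))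
∑-comm (x ∷ xs) ys f = begin
  ∑ ys (f x) + ∑ xs (λ x → ∑ ys (f x))         ≡⟨ cong (∑ ys (f x) +_) (∑-comm xs ys f) ⟩
  ∑ ys (f x) + ∑ ys (λ y → ∑ xs (λ x → f x y)) ≡⟨ sym (∑-+ ys (f x) _) ⟩
  ∑ ys (λ y → f x y + ∑ xs (λ x → f x y))      ∎
  where open ≡-Reasoning

∈⇒≤∑ : ∀ {xs} (f : A → ℕ) {x} → x ∈ₗ xs → f x ≤ ∑ xs f
∈⇒≤∑ f (here refl) = m≤m+n _ _
∈⇒≤∑ f (there x∈xs) = ≤-trans (∈⇒≤∑ f x∈xs) (m≤n+m _ _)

+-cancel-≤-< : ∀ {m n p q} → m + n ≤ p + q → p < m → n ≤ q
+-cancel-≤-< m+n≤p+q p<m = ≮⇒≥ (λ q<n → <⇒≱ (+-mono-< p<m q<n) m+n≤p+q)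

∑≤⇒∃≤ : ∀ x xs (f : A → ℕ) c → ∑ (x ∷ xs) f ≤ length (x ∷ xs) * c →
         ∃[ y ] y ∈ₗ x ∷ xs × f y ≤ c
∑≤⇒∃≤ x xs f c ∑≤ with f x ≤? c
... | yes fx≤c = x , here refl , fx≤c
∑≤⇒∃≤ x [] f c ∑≤ | no fx≰c =
  contradiction (+-cancelʳ-≤ 0 (f x) c ∑≤) fx≰c
∑≤⇒∃≤ x (y ∷ ys) f c ∑≤ | no fx≰c
  with z , z∈ , fz≤c ← ∑≤⇒∃≤ y ys f c (+-cancel-≤-< ∑≤ (≰⇒> fx≰c))
  = z , there z∈ , fz≤c

indicator : {P : Set ℓ} → Dec P → ℕ
indicator p = if does p then 1 else 0

count : {P : Pred A ℓ} → Decidable P → List A → ℕ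
count P? xs = ∑ xs (indicator ∘ P?)

module _ {P : Pred A ℓ} (P? : Decidable P) where

  count-≥1 : ∀ {xs x} → x ∈ₗ xs → P x → 1 ≤ count P? xs
  count-≥1 {x = x} x∈xs Px with P? x in eq
  ... | yes _  = ≤-trans (≤-reflexive (cong indicator (sym eq))) (∈⇒≤∑ (indicator ∘ P?) x∈xs)
  ... | no ¬Px = contradiction Px ¬Px

  count-none : ∀ {xs} → All (∁ P) xs → count P? xs ≡ 0
  count-none {[]}     []          = refl
  count-none {x ∷ xs} (¬Px ∷ ¬Ps) with P? x
  ... | yes Px = contradiction Px ¬Px
  ... | no _   = count-none ¬Ps

  count≤1 : ∀ {xs} → Unique xs → (∀ {x y} → P x → P y → x ≡ y) → count P? xs ≤ 1
  count≤1 {[]}     []             P-unique = z≤n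
  count≤1 {x ∷ xs} (x∉xs ∷ uniq) P-unique with P? x
  ... | yes Px = ≤-reflexive (cong suc (count-none (All.map (λ x≢y Py → x≢y (P-unique Px Py)) x∉xs)))
  ... | no _   = count≤1 uniq P-unique

  length-filter-∁+count : ∀ xs → length (filter (∁? P?) xs) + count P? xs ≡ length xs
  length-filter-∁+count []       = refl
  length-filter-∁+count (x ∷ xs) with P? x
  ... | yes _ = trans (+-suc _ _) (cong suc (length-filter-∁+count xs))
  ... | no _  = cong suc (length-filter-∁+count xs)

indicator-⊎ : {P : Set a} {Q : Set b} (p : Dec P) (q : Dec Q) →
              indicator (p ⊎-dec q) ≤ indicator p + indicator q
indicator-⊎ (yes _) q      = s≤s z≤n
indicator-⊎ (no _)  (yes _) = ≤-refl
indicator-⊎ (no _)  (no _)  = z≤n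

indicator-any≤∑ : {P : Pred A ℓ} (P? : Decidable P) (xs : List A) →
                  indicator (any? P? xs) ≤ ∑ xs (indicator ∘ P?)
indicator-any≤∑ P? []       = z≤n
indicator-any≤∑ P? (x ∷ xs) =
  ≤-trans (indicator-⊎ (P? x) (any? P? xs)) (+-monoʳ-≤ _ (indicator-any≤∑ P? xs))

count-meeting≤length : {Q : A → Pred B ℓ} (Q? : ∀ i → Decidable (Q i)) →
  (∀ {i j v} → Q i v → Q j v → i ≡ j) →
  ∀ {xs} → Unique xs → ∀ vs → count (λ i → any? (Q? i) vs) xs ≤ length vs
count-meeting≤length Q? disjoint {xs} uniq vs = begin
  ∑ xs (λ i → indicator (any? (Q? i) vs))          ≤⟨ ∑-mono-≤ xs (λ i → indicator-any≤∑ (Q? i) vs) ⟩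
  ∑ xs (λ i → ∑ vs (λ v → indicator (Q? i v)))     ≡⟨ ∑-comm xs vs _ ⟩
  ∑ vs (λ v → count (λ i → Q? i v) xs)             ≤⟨ ∑-mono-≤ vs (λ v → count≤1 (λ i → Q? i v) uniq disjoint) ⟩
  ∑ vs (λ _ → 1)                                   ≡⟨ ∑-const vs 1 ⟩
  length vs * 1                                    ≡⟨ *-identityʳ _ ⟩
  length vs                                        ∎
  where open ≤-Reasoning

fromList : ∀ {n} → List (Fin n) → Subset n
fromList []       = ⊥
fromList (x ∷ xs) = ⁅ x ⁆ ∪ fromList xs

∈-fromList⁻ : ∀ {n} {x : Fin n} xs → x ∈ fromList xs → x ∈ₗ xs
∈-fromList⁻ []       x∈ = contradiction x∈ ∉⊥
∈-fromList⁻ (y ∷ ys) x∈ with x∈p∪q⁻ ⁅ y ⁆ (fromList ys) x∈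
... | inj₁ x∈⁅y⁆ = here (x∈⁅y⁆⇒x≡y y x∈⁅y⁆)
... | inj₂ x∈ys  = there (∈-fromList⁻ ys x∈ys)

∣⁅x⁆∪p∣≡1+∣p∣ : ∀ {n} (x : Fin n) p → x ∉ p → ∣ ⁅ x ⁆ ∪ p ∣ ≡ suc ∣ p ∣
∣⁅x⁆∪p∣≡1+∣p∣ zero    (outside ∷ᵥ p) x∉p = cong (suc ∘ ∣_∣) (∪-identityˡ p)
∣⁅x⁆∪p∣≡1+∣p∣ zero    (inside  ∷ᵥ p) x∉p = contradiction here x∉p
∣⁅x⁆∪p∣≡1+∣p∣ (suc x) (outside ∷ᵥ p) x∉p = ∣⁅x⁆∪p∣≡1+∣p∣ x p (x∉p ∘ there)
∣⁅x⁆∪p∣≡1+∣p∣ (suc x) (inside  ∷ᵥ p) x∉p = cong suc (∣⁅x⁆∪p∣≡1+∣p∣ x p (x∉p ∘ there))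

∣fromList∣ : ∀ {n} {xs : List (Fin n)} → Unique xs → ∣ fromList xs ∣ ≡ length xs
∣fromList∣ {n} {[]}     []            = ∣⊥∣≡0 n
∣fromList∣ {xs = x ∷ xs} (x∉xs ∷ uniq) =
  trans (∣⁅x⁆∪p∣≡1+∣p∣ x (fromList xs) (λ x∈ → All.lookup x∉xs (∈-fromList⁻ xs x∈) refl))
        (cong suc (∣fromList∣ uniq))

module IndependentSets
  {A : Set a} (_≟_ : DecidableEquality A)
  {R : A → A → Set ℓ} (R? : ∀ x y → Dec (R x y))
  (d : ℕ) (in-degree≤ : ∀ {xs} → Unique xs → ∀ y → count (λ x → R? x y) xs ≤ d)
  where

  Independent : List A → Set (a ⊔ ℓ)
  Independent ys = ∀ {x y} → x ∈ₗ ys → y ∈ₗ ys → x ≢ y → ¬ R x y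

  -- Reflexive on purpose: discarding the neighbours of x also discards x itself.
  Adjacent : A → A → Set (a ⊔ ℓ)
  Adjacent x y = x ≡ y ⊎ R x y ⊎ R y x

  adjacent? : ∀ x → Decidable (Adjacent x)
  adjacent? x y = x ≟ y ⊎-dec R? x y ⊎-dec R? y x

  degree : List A → A → ℕ
  degree xs x = count (adjacent? x) xs

  non-neighbours : A → List A → List A
  non-neighbours x = filter (∁? (adjacent? x))

  record LargeIndependentSublist (xs : List A) : Set (a ⊔ ℓ) where
    field
      members     : List A
      members⊆    : members ⊆ xs
      unique      : Unique members
      independent : Independent members
      large       : length xs ≤ (2 * d + 1) * length members

  ∑-degree≤ : ∀ {xs} → Unique xs → ∑ xs (degree xs) ≤ length xs * (2 * d + 1)
  ∑-degree≤ {xs} uniq = begin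
    ∑ xs (degree xs)                               ≤⟨ ∑-mono-≤ xs degree≤ ⟩
    ∑ xs (λ x → self x + (out x + in′ x))          ≡⟨ ∑-+ xs self _ ⟩
    ∑ xs self + ∑ xs (λ x → out x + in′ x)         ≡⟨ cong (∑ xs self +_) (∑-+ xs out in′) ⟩
    ∑ xs self + (∑ xs out + ∑ xs in′)              ≡⟨ cong (λ m → ∑ xs self + (m + ∑ xs in′)) (∑-comm xs xs _) ⟩
    ∑ xs self + (∑ xs in′ + ∑ xs in′)              ≤⟨ +-mono-≤ ∑-self≤ (+-mono-≤ ∑-in≤ ∑-in≤) ⟩
    length xs * 1 + (length xs * d + length xs * d) ≡⟨ collect (length xs) d ⟩
    length xs * (2 * d + 1)                        ∎
    where
    open ≤-Reasoning
    collect : ∀ n d → n * 1 + (n * d + n * d) ≡ n * (2 * d + 1)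
    collect = solve-∀
    self out in′ : A → ℕ
    self x = count (x ≟_) xs
    out  x = count (R? x) xs
    in′  y = count (λ x → R? x y) xs
    degree≤ : ∀ x → degree xs x ≤ self x + (out x + in′ x)
    degree≤ x = ≤-trans
      (∑-mono-≤ xs λ y → ≤-trans (indicator-⊎ (x ≟ y) (R? x y ⊎-dec R? y x))
                                 (+-monoʳ-≤ (indicator (x ≟ y)) (indicator-⊎ (R? x y) (R? y x))))
      (≤-reflexive (trans (∑-+ xs _ _) (cong (self x +_) (∑-+ xs _ _))))
    ∑-self≤ : ∑ xs self ≤ length xs * 1
    ∑-self≤ = ≤-trans (∑-mono-≤ xs (λ x → count≤1 (x ≟_) uniq (λ x≡y x≡z → trans (sym x≡y) x≡z)))
                      (≤-reflexive (∑-const xs 1))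
    ∑-in≤ : ∑ xs in′ ≤ length xs * d
    ∑-in≤ = ≤-trans (∑-mono-≤ xs (in-degree≤ uniq)) (≤-reflexive (∑-const xs d))

  low-degree-member : ∀ x xs → Unique (x ∷ xs) → ∃[ y ] y ∈ₗ x ∷ xs × degree (x ∷ xs) y ≤ 2 * d + 1
  low-degree-member x xs uniq = ∑≤⇒∃≤ x xs (degree (x ∷ xs)) (2 * d + 1) (∑-degree≤ uniq)

  length-non-neighbours : ∀ x xs → length (non-neighbours x xs) + degree xs x ≡ length xs
  length-non-neighbours x = length-filter-∁+count (adjacent? x)

  ∈-non-neighbours⁻ : ∀ {x y} xs → y ∈ₗ non-neighbours x xs → y ∈ₗ xs × ¬ Adjacent x y
  ∈-non-neighbours⁻ {x} xs = ∈-filter⁻ (∁? (adjacent? x)) {xs = xs}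

  non-neighbours-shorter : ∀ {x xs} → x ∈ₗ xs → length (non-neighbours x xs) < length xs
  non-neighbours-shorter {x} {xs} x∈xs = begin-strict
    length (non-neighbours x xs)                 <⟨ m<m+n _ (count-≥1 (adjacent? x) x∈xs (inj₁ refl)) ⟩
    length (non-neighbours x xs) + degree xs x   ≡⟨ length-non-neighbours x xs ⟩
    length xs                                    ∎
    where open ≤-Reasoning

  extend : ∀ {x xs} → x ∈ₗ xs → degree xs x ≤ 2 * d + 1 →
           LargeIndependentSublist (non-neighbours x xs) → LargeIndependentSublist xs
  extend {x} {xs} x∈xs degree≤ I = record
    { members     = x ∷ members
    ; members⊆    = λ { (here refl) → x∈xs ; (there y∈) → proj₁ (∈-non-neighbours⁻ xs (members⊆ y∈)) }
    ; unique      = All.tabulate (λ y∈ x≡y → far y∈ (inj₁ x≡y)) ∷ unique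
    ; independent = independent′
    ; large       = large′
    }
    where
    open LargeIndependentSublist I
    c : ℕ
    c = 2 * d + 1
    far : ∀ {y} → y ∈ₗ members → ¬ Adjacent x y
    far y∈ = proj₂ (∈-non-neighbours⁻ xs (members⊆ y∈))
    independent′ : Independent (x ∷ members)
    independent′ (here refl) (here refl) x≢x  = contradiction refl x≢x
    independent′ (here refl) (there z∈)  _ Rxz = far z∈ (inj₂ (inj₁ Rxz))
    independent′ (there y∈)  (here refl) _ Ryx = far y∈ (inj₂ (inj₂ Ryx))
    independent′ (there y∈)  (there z∈)       = independent y∈ z∈
    large′ : length xs ≤ c * suc (length members)
    large′ = begin
      length xs                                      ≡⟨ sym (length-non-neighbours x xs) ⟩
      length (non-neighbours x xs) + degree xs x     ≤⟨ +-mono-≤ large degree≤ ⟩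
      c * length members + c                         ≡⟨ +-comm _ c ⟩
      c + c * length members                         ≡⟨ sym (*-suc c _) ⟩
      c * suc (length members)                       ∎
      where open ≤-Reasoning

  large-independent-sublist : ∀ xs → Unique xs → LargeIndependentSublist xs
  large-independent-sublist xs = go (length xs) xs ≤-refl
    where
    go : ∀ n xs → length xs ≤ n → Unique xs → LargeIndependentSublist xs
    go n       []       _        _    = record
      { members = [] ; members⊆ = λ () ; unique = [] ; independent = λ () ; large = z≤n }
    go (suc n) (x ∷ xs) ∣xs∣≤1+n uniq
      with y , y∈ , degree≤ ← low-degree-member x xs uniq
      = extend y∈ degree≤ (go n (non-neighbours y (x ∷ xs))
          (<⇒≤pred (≤-trans (non-neighbours-shorter y∈) ∣xs∣≤1+n))
          (filter⁺ (∁? (adjacent? y)) uniq))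

proposition2p4 : ∀ {n : ℕ} (G : Graph n) (s t : ℕ)
    (S : Fin s → Subset n) (P : Fin s → Path G) →
    (∀ i j (v : Fin n) → v ∈ S i → v ∈ S j → i ≡ j) →
    (∀ j → len (P j) ≤ t) →
    Σ (Subset s) λ I →
    (s ≤ (2 * t + 3) * ∣ I ∣) ×
    (∀ i j → i ∈ I → j ∈ I → ¬ i ≡ j →
    ∀ (v : Fin n) → v ∈ S i → ¬ v ∈ₗ vertices (P j))
proposition2p4 G s t S P disjoint short = fromList members , size , separated
  where
  meets? : ∀ i j → Dec (Any (_∈ S i) (vertices (P j)))
  meets? i j = any? (_∈? S i) (vertices (P j))
  in-degree≤ : ∀ {xs} → Unique xs → ∀ j → count (λ i → meets? i j) xs ≤ suc t
  in-degree≤ uniq j = ≤-trans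
    (count-meeting≤length (λ i v → v ∈? S i) (λ {i} {j} {v} → disjoint i j v) uniq (vertices (P j)))
    (s≤s (short j))
  open IndependentSets Fin._≟_ meets? (suc t) in-degree≤
  open LargeIndependentSublist (large-independent-sublist (allFin s) (allFin⁺ s))
  size : s ≤ (2 * t + 3) * ∣ fromList members ∣
  size = subst₂ _≤_ (length-tabulate id) (cong₂ _*_ (2[1+t]+1 t) (sym (∣fromList∣ unique))) large
    where
    2[1+t]+1 : ∀ t → 2 * suc t + 1 ≡ 2 * t + 3
    2[1+t]+1 = solve-∀
  separated : ∀ i j → i ∈ fromList members → j ∈ fromList members → i ≢ j →
              ∀ v → v ∈ S i → ¬ v ∈ₗ vertices (P j)
  separated i j i∈ j∈ i≢j v v∈Si v∈Pj =
    independent (∈-fromList⁻ members i∈) (∈-fromList⁻ members j∈) i≢j (lose v∈Pj v∈Si)
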